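{- Let $m$ be a non-negative integer, $k$ a positive integer, and $A,D$ two $k$-tuples of elements of $\mathbb{Z}/m\mathbb{Z}$. Then for every non-negative integer $i$, $$\partial^{i}\,\mathrm{IAP}(A,D)=(-1)^i\,\mathrm{IAP}\big(AC_k^{(i)}+DT_k^{(i)},\ DC_k^{(i)}\big).$$
   Context: $\mathbb{Z}/0\mathbb{Z}$ is identified with $\mathbb{Z}$. For $k$-tuples $A=(a_0,\dots,a_{k-1})$, $D=(d_0,\dots,d_{k-1})$, $\mathrm{IAP}(A,D)$ is the doubly infinite sequence $(u_j)_{j\in\mathbb{Z}}$ with $u_{qk+r}=a_r+qd_r$. The derived sequence of $(u_j)_{j\in\mathbb{Z}}$ is $\partial(u_j)=(-u_j-u_{j+1})_{j\in\mathbb{Z}}$, and $\partial^i$ is its $i$-th iterate ($\partial^0$ the identity). The $k\times k$ integer matrices are $(C_k^{(i)})_{r,s}=\sum_{\alpha\in\mathbb{Z}}\binom{i}{\alpha k+r-s}$ and $(T_k^{(i)})_{r,s}=\sum_{\alpha\in\mathbb{Z}}\alpha\binom{i}{\alpha k+r-s}$ for $r,s\in\{1,\dots,k\}$, with $\binom{a}{b}=0$ for $b<0$ or $b>a$. Tuples are row vectors; products with integer matrices are computed in $\mathbb{Z}/m\mathbb{Z}$; a scalar times an IAP multiplies every term. -}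

module Defs where

open import Data.Nat as ℕ using (ℕ; zero; suc; NonZero)
open import Data.Nat.Combinatorics using (_C_)
open import Data.Integer using (ℤ; +_; -[1+_]; _+_; _-_; _*_; -_; _^_; _/ℕ_; _%ℕ_)
open import Data.Integer.DivMod using (n%ℕd<d)
open import Data.Integer.Divisibility using (_∣_)
open import Data.Fin using (Fin; toℕ; fromℕ<)

infix 4 _≡[mod_]_ _≈[mod_]_
infixr 7 _·_
infixl 7 _⊛_
infixl 6 _⊕_

-- Elements of ℤ/mℤ are represented by integers; equality in ℤ/mℤ is
-- congruence modulo m (for m = 0 this is equality in ℤ, as ℤ/0ℤ = ℤ).
_≡[mod_]_ : ℤ → ℕ → ℤ → Set
x ≡[mod m ] y = + m ∣ (x - y)

Tuple : ℕ → Set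
Tuple k = Fin k → ℤ

Seq : Set
Seq = ℤ → ℤ

_≈[mod_]_ : Seq → ℕ → Seq → Set
u ≈[mod m ] v = ∀ j → u j ≡[mod m ] v j

IAP : (k : ℕ) .{{_ : NonZero k}} → Tuple k → Tuple k → Seq
IAP k A D j = A r + q * D r
  where
  r : Fin k
  r = fromℕ< (n%ℕd<d j k)
  q : ℤ
  q = j /ℕ k

∂ : Seq → Seq
∂ u j = - u j - u (j + + 1)

∂^ : ℕ → Seq → Seq
∂^ zero    u = u
∂^ (suc i) u = ∂ (∂^ i u)

_·_ : ℤ → Seq → Seq
(c · u) j = c * u j

-- binomial coefficient with integer lower argument:
-- binom a b = 0 for b < 0 or b > a (the stdlib's a C b is 0 for b > a)
binom : ℕ → ℤ → ℤ
binom a (+ b)    = + (a C b)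
binom a -[1+ b ] = + 0

sumℕ : ℕ → (ℕ → ℤ) → ℤ
sumℕ zero    f = + 0
sumℕ (suc n) f = sumℕ n f + f n

sumFin : (k : ℕ) → (Fin k → ℤ) → ℤ
sumFin zero    f = + 0
sumFin (suc k) f = f Fin.zero + sumFin k (λ r → f (Fin.suc r))
  where import Data.Fin as Fin

-- Σ_{α ∈ ℤ} g(α) for g supported in [-(i+1), i+1]: we sum over
-- α = t - (i+1), t = 0 … 2(i+1).  For k ≥ 1 and 0 ≤ r,s < k the summands
-- binom i (αk + r - s) below vanish outside this range, so this is exactly
-- the (finitely supported) sum over all α ∈ ℤ of the paper.
sumα : ℕ → (ℤ → ℤ) → ℤ
sumα i g = sumℕ (suc (2 ℕ.* suc i)) (λ t → g (+ t - + suc i))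

Cmat : (k i : ℕ) → Fin k → Fin k → ℤ
Cmat k i r s = sumα i (λ α → binom i (α * + k + + toℕ r - + toℕ s))

Tmat : (k i : ℕ) → Fin k → Fin k → ℤ
Tmat k i r s = sumα i (λ α → α * binom i (α * + k + + toℕ r - + toℕ s))

_⊛_ : {k : ℕ} → Tuple k → (Fin k → Fin k → ℤ) → Tuple k
_⊛_ {k} A M s = sumFin k (λ r → A r * M r s)

_⊕_ : {k : ℕ} → Tuple k → Tuple k → Tuple k
(A ⊕ B) r = A r + B r

{-# OPTIONS --safe #-}
-- Induction on i, proving ∂^i u_{qk+c} = (-1)^i (A_i(c) + q D_i(c)) for u = IAP(A,D), where
-- A_i = A C^(i) + D T^(i) and D_i = D C^(i) (A′ i c and D′ i c below). Since ∂ combines the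
-- terms at columns c and c + 1, the step is Pascal's rule binom(i+1, x) = binom(i, x) + binom(i, x-1),
-- which gives C^(i+1)_{r,c} = C^(i)_{r,c} + C^(i)_{r,c+1}, and likewise for T, once the column
-- index may reach k. Column k is column 0 of the next block: shifting α by one gives
-- C^(i)_{r,k} = C^(i)_{r,0} and T^(i)_{r,k} = T^(i)_{r,0} + C^(i)_{r,0}, matching u_{qk+k} = u_{(q+1)k}.
-- The identity holds in ℤ.
module Submission where

open import Defs
open import Data.Nat using (ℕ; NonZero)
open import Data.Integer using (ℤ; -_; +_; _^_)

open import Data.Nat as ℕ using (zero; suc; _<_; _≤_; _∸_)
import Data.Nat.Properties as ℕ
open import Data.Nat.Combinatorics using (_C_; nCk+nC[k+1]≡[n+1]C[k+1]; k>n⇒nCk≡0)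
open import Data.Nat.Divisibility using (_∣0)
open import Data.Integer using (-[1+_]; _+_; _-_; _*_; _/ℕ_; _%ℕ_; 0ℤ; 1ℤ; -1ℤ)
import Data.Integer.Properties as ℤ
open import Data.Integer.DivMod using (n%ℕd<d; a≡a%ℕn+[a/ℕn]*n)
open import Algebra.Properties.CommutativeSemigroup ℤ.+-commutativeSemigroup using (interchange)
open import Data.Integer.Tactic.RingSolver using (solve-∀)
open import Data.Fin using (Fin; zero; suc; toℕ; fromℕ<)
import Data.Fin.Properties as Fin
open import Data.Product using (_×_; _,_; proj₁; proj₂)
open import Data.Vec.Functional using (tail)
open import Data.Sum using (inj₁; inj₂)
open import Relation.Nullary using (contradiction)
open import Relation.Binary.PropositionalEquality
open ≡-Reasoning

≡⇒≡[mod] : ∀ {x y} m → x ≡ y → x ≡[mod m ] y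
≡⇒≡[mod] {x} m refl rewrite ℤ.+-inverseʳ x = m ∣0

split-≤ : ∀ {m n} → m ≤ n → n ≡ m ℕ.+ (n ∸ m)
split-≤ m≤n = sym (ℕ.m+[n∸m]≡n m≤n)

sumℕ-cong : ∀ n {f g : ℕ → ℤ} → (∀ t → f t ≡ g t) → sumℕ n f ≡ sumℕ n g
sumℕ-cong zero    f≡g = refl
sumℕ-cong (suc n) f≡g = cong₂ _+_ (sumℕ-cong n f≡g) (f≡g n)

sumℕ-vanishes : ∀ n {f : ℕ → ℤ} → (∀ t → t < n → f t ≡ 0ℤ) → sumℕ n f ≡ 0ℤ
sumℕ-vanishes zero    f≡0 = refl
sumℕ-vanishes (suc n) f≡0 =
  cong₂ _+_ (sumℕ-vanishes n (λ t t<n → f≡0 t (ℕ.m<n⇒m<1+n t<n))) (f≡0 n ℕ.≤-refl)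

sumℕ-+ : ∀ n (f g : ℕ → ℤ) → sumℕ n (λ t → f t + g t) ≡ sumℕ n f + sumℕ n g
sumℕ-+ zero    f g = refl
sumℕ-+ (suc n) f g = trans (cong (_+ (f n + g n)) (sumℕ-+ n f g))
                           (interchange (sumℕ n f) (sumℕ n g) (f n) (g n))

sumℕ-sucˡ : ∀ n (f : ℕ → ℤ) → sumℕ (suc n) f ≡ f 0 + sumℕ n (λ t → f (suc t))
sumℕ-sucˡ zero    f = ℤ.+-comm 0ℤ (f 0)
sumℕ-sucˡ (suc n) f = trans (cong (_+ f (suc n)) (sumℕ-sucˡ n f))
                            (ℤ.+-assoc (f 0) (sumℕ n (λ t → f (suc t))) (f (suc n)))

sumℕ-split : ∀ a b (f : ℕ → ℤ) → sumℕ (a ℕ.+ b) f ≡ sumℕ a f + sumℕ b (λ t → f (a ℕ.+ t))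
sumℕ-split a zero    f rewrite ℕ.+-identityʳ a = sym (ℤ.+-identityʳ (sumℕ a f))
sumℕ-split a (suc b) f rewrite ℕ.+-suc a b =
  trans (cong (_+ f (a ℕ.+ b)) (sumℕ-split a b f))
        (ℤ.+-assoc (sumℕ a f) (sumℕ b (λ t → f (a ℕ.+ t))) (f (a ℕ.+ b)))

sumα-nonnegative : ∀ i (g : ℤ → ℤ) → (∀ n → g -[1+ n ] ≡ 0ℤ) →
                   sumα i g ≡ sumℕ (suc (suc i)) (λ a → g (+ a))
sumα-nonnegative i g g-neg = begin
  sumℕ (suc (2 ℕ.* suc i)) G
    ≡⟨ cong (λ n → sumℕ n G) length ⟩
  sumℕ (suc i ℕ.+ suc (suc i)) G
    ≡⟨ sumℕ-split (suc i) (suc (suc i)) G ⟩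
  sumℕ (suc i) G + sumℕ (suc (suc i)) (λ a → G (suc i ℕ.+ a))
    ≡⟨ cong₂ _+_ (sumℕ-vanishes (suc i) negative)
                 (sumℕ-cong (suc (suc i)) (λ a → cong g (cancel (+ suc i) (+ a)))) ⟩
  0ℤ + sumℕ (suc (suc i)) (λ a → g (+ a))
    ≡⟨ ℤ.+-identityˡ _ ⟩
  sumℕ (suc (suc i)) (λ a → g (+ a)) ∎
  where
  G : ℕ → ℤ
  G t = g (+ t - + suc i)
  length : suc (2 ℕ.* suc i) ≡ suc i ℕ.+ suc (suc i)
  length = trans (cong (λ n → suc (suc i ℕ.+ n)) (ℕ.+-identityʳ (suc i))) (sym (ℕ.+-suc (suc i) (suc i)))
  cancel : ∀ M A → (M + A) - M ≡ A
  cancel = solve-∀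
  below : ∀ T D → T - (+ 1 + (T + D)) ≡ - (+ 1 + D)
  below = solve-∀
  negative : ∀ t → t < suc i → G t ≡ 0ℤ
  negative t t<1+i = trans (cong g (subst (λ n → + t - + n ≡ -[1+ suc i ∸ suc t ]) (sym (split-≤ t<1+i))
                                          (below (+ t) (+ (suc i ∸ suc t)))))
                           (g-neg _)

infix 7 _∙_

_∙_ : ∀ {n} → Tuple n → Tuple n → ℤ
_∙_ {n} A v = sumFin n (λ r → A r * v r)

∙-cong : ∀ {n} (A : Tuple n) {v w : Tuple n} → (∀ r → v r ≡ w r) → A ∙ v ≡ A ∙ w
∙-cong {zero}  A v≡w = refl
∙-cong {suc n} A v≡w = cong₂ _+_ (cong (A zero *_) (v≡w zero)) (∙-cong (tail A) (λ r → v≡w (suc r)))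

∙-distribˡ-+ : ∀ {n} (A v w : Tuple n) → A ∙ (λ r → v r + w r) ≡ A ∙ v + A ∙ w
∙-distribˡ-+ {zero}  A v w = refl
∙-distribˡ-+ {suc n} A v w = begin
  A zero * (v zero + w zero) + tail A ∙ (λ r → v (suc r) + w (suc r))
    ≡⟨ cong₂ _+_ (ℤ.*-distribˡ-+ (A zero) (v zero) (w zero)) (∙-distribˡ-+ (tail A) (tail v) (tail w)) ⟩
  (A zero * v zero + A zero * w zero) + (tail A ∙ tail v + tail A ∙ tail w)
    ≡⟨ interchange (A zero * v zero) (A zero * w zero) (tail A ∙ tail v) (tail A ∙ tail w) ⟩
  A ∙ v + A ∙ w ∎

∙-zeroʳ : ∀ {n} (A : Tuple n) → A ∙ (λ _ → 0ℤ) ≡ 0ℤ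
∙-zeroʳ {zero}  A = refl
∙-zeroʳ {suc n} A = cong₂ _+_ (ℤ.*-zeroʳ (A zero)) (∙-zeroʳ (tail A))

∙-δ : ∀ {n} (A : Tuple n) s → A ∙ (λ r → binom 0 (+ toℕ r - + toℕ s)) ≡ A s
∙-δ {suc n} A zero = begin
  A zero * 1ℤ + tail A ∙ (λ _ → 0ℤ) ≡⟨ cong₂ _+_ (ℤ.*-identityʳ (A zero)) (∙-zeroʳ (tail A)) ⟩
  A zero + 0ℤ                       ≡⟨ ℤ.+-identityʳ (A zero) ⟩
  A zero                            ∎
∙-δ {suc n} A (suc s) = begin
  A zero * 0ℤ + tail A ∙ (λ r → binom 0 (+ suc (toℕ r) - + suc (toℕ s)))
    ≡⟨ cong₂ _+_ (ℤ.*-zeroʳ (A zero))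
                 (∙-cong (tail A) (λ r → cong (binom 0) (identity (+ toℕ r) (+ toℕ s)))) ⟩
  0ℤ + tail A ∙ (λ r → binom 0 (+ toℕ r - + toℕ s))
    ≡⟨ ℤ.+-identityˡ _ ⟩
  tail A ∙ (λ r → binom 0 (+ toℕ r - + toℕ s))
    ≡⟨ ∙-δ (tail A) s ⟩
  A (suc s) ∎
  where
  identity : ∀ R S → (+ 1 + R) - (+ 1 + S) ≡ R - S
  identity = solve-∀

binom-pascal : ∀ i x → binom (suc i) x ≡ binom i x + binom i (x - + 1)
binom-pascal i (+ zero)  = refl
binom-pascal i (+ suc b) =
  cong +_ (sym (trans (ℕ.+-comm (i C suc b) (i C b)) (nCk+nC[k+1]≡[n+1]C[k+1] i b)))
binom-pascal i -[1+ b ]  = refl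

binom-above : ∀ i {n} → i < n → binom i (+ n) ≡ 0ℤ
binom-above i i<n = cong +_ (k>n⇒nCk≡0 i<n)

div-mod-decomposition : ∀ j k .{{_ : NonZero k}} → j ≡ (j /ℕ k) * + k + + toℕ (fromℕ< (n%ℕd<d j k))
div-mod-decomposition j k = begin
  j
    ≡⟨ a≡a%ℕn+[a/ℕn]*n j k ⟩
  + (j %ℕ k) + (j /ℕ k) * + k
    ≡⟨ ℤ.+-comm (+ (j %ℕ k)) ((j /ℕ k) * + k) ⟩
  (j /ℕ k) * + k + + (j %ℕ k)
    ≡⟨ cong (λ n → (j /ℕ k) * + k + + n) (Fin.toℕ-fromℕ< (n%ℕd<d j k)) ⟨
  (j /ℕ k) * + k + + toℕ (fromℕ< (n%ℕd<d j k)) ∎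

module Period (k′ : ℕ) where

  k : ℕ
  k = suc k′

  no-positive-multiple : ∀ {s s′} n → s < k → + s ≢ + s′ + + suc n * + k
  no-positive-multiple {s} {s′} n s<k eq = ℕ.<⇒≱ s<k
    (subst (k ≤_) (sym (ℤ.+-injective eq)) (ℕ.≤-trans (ℕ.m≤n*m k (suc n)) (ℕ.m≤n+m (suc n ℕ.* k) s′)))

  multiple-vanishes : ∀ d {s s′} → s < k → s′ < k → + s ≡ + s′ + d * + k → d ≡ 0ℤ
  multiple-vanishes (+ zero)  _   _    _  = refl
  multiple-vanishes (+ suc n) s<k _    eq = contradiction eq (no-positive-multiple n s<k)
  multiple-vanishes -[1+ n ] {s} {s′} _ s′<k eq =
    contradiction (trans (cancel (+ s′) -[1+ n ] (+ k)) (cong (λ x → x + + suc n * + k) (sym eq)))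
                  (no-positive-multiple n s′<k)
    where
    cancel : ∀ S D K → S ≡ (S + D * K) + (- D) * K
    cancel = solve-∀

  euclidean-unique : ∀ q q′ (r r′ : Fin k) → q * + k + + toℕ r ≡ q′ * + k + + toℕ r′ → q ≡ q′ × r ≡ r′
  euclidean-unique q q′ r r′ eq = sym (ℤ.i-j≡0⇒i≡j q′ q d≡0) , Fin.toℕ-injective (ℤ.+-injective r≡r′)
    where
    rearrange : ∀ Q Q′ R R′ → Q * + k + R ≡ Q′ * + k + R′ → R ≡ R′ + (Q′ - Q) * + k
    rearrange Q Q′ R R′ e = begin
      R                          ≡⟨ isolate Q R (+ k) ⟩
      (Q * + k + R) - Q * + k    ≡⟨ cong (_- Q * + k) e ⟩
      (Q′ * + k + R′) - Q * + k  ≡⟨ collect Q Q′ R′ (+ k) ⟩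
      R′ + (Q′ - Q) * + k        ∎
      where
      isolate : ∀ Q R K → R ≡ (Q * K + R) - Q * K
      isolate = solve-∀
      collect : ∀ Q Q′ R′ K → (Q′ * K + R′) - Q * K ≡ R′ + (Q′ - Q) * K
      collect = solve-∀
    r-rel : + toℕ r ≡ + toℕ r′ + (q′ - q) * + k
    r-rel = rearrange q q′ (+ toℕ r) (+ toℕ r′) eq
    d≡0 : q′ - q ≡ 0ℤ
    d≡0 = multiple-vanishes (q′ - q) (Fin.toℕ<n r) (Fin.toℕ<n r′) r-rel
    r≡r′ : + toℕ r ≡ + toℕ r′
    r≡r′ = trans r-rel (trans (cong (λ d → + toℕ r′ + d * + k) d≡0) (ℤ.+-identityʳ (+ toℕ r′)))

  IAP-at-qk+s : ∀ (A D : Tuple k) q (s : Fin k) → IAP k A D (q * + k + + toℕ s) ≡ A s + q * D s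
  IAP-at-qk+s A D q s = cong₂ (λ r q′ → A r + q′ * D r) (proj₂ unique) (proj₁ unique)
    where
    j : ℤ
    j = q * + k + + toℕ s
    unique : j /ℕ k ≡ q × fromℕ< (n%ℕd<d j k) ≡ s
    unique = euclidean-unique (j /ℕ k) q (fromℕ< (n%ℕd<d j k)) s (sym (div-mod-decomposition j k))

  -- Entries of C_k^(i) and T_k^(i)

  entry : ℕ → ℕ → ℕ → ℤ → ℤ
  entry i r c α = binom i (α * + k + + r - + c)

  binom-beyond-multiple : ∀ i n → binom i (+ suc i * + k + + n) ≡ 0ℤ
  binom-beyond-multiple i n = binom-above i (ℕ.≤-trans (ℕ.m≤m*n (suc i) k) (ℕ.m≤m+n (suc i ℕ.* k) n))

  entry-pascal : ∀ i r c α → entry (suc i) r c α ≡ entry i r c α + entry i r (suc c) α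
  entry-pascal i r c α =
    trans (binom-pascal i _) (cong (λ x → entry i r c α + binom i x) (identity (α * + k) (+ r) (+ c)))
    where
    identity : ∀ X R C → X + R - C - + 1 ≡ X + R - (+ 1 + C)
    identity = solve-∀

  -- k is written as c + e, so that the ring solver can use c ≤ k.
  entry-vanishes-above : ∀ i r {c} → c ≤ k → entry i r c (+ suc (suc i)) ≡ 0ℤ
  entry-vanishes-above i r {c} c≤k = trans (cong (binom i) argument) (binom-beyond-multiple i (k ∸ c ℕ.+ r))
    where
    identity : ∀ I R C E → (+ 1 + (+ 1 + I)) * (C + E) + R - C ≡ (+ 1 + I) * (C + E) + (E + R)
    identity = solve-∀
    argument : + suc (suc i) * + k + + r - + c ≡ + suc i * + k + + (k ∸ c ℕ.+ r)
    argument = subst (λ n → + suc (suc i) * + n + + r - + c ≡ + suc i * + n + + (k ∸ c ℕ.+ r))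
                     (sym (split-≤ c≤k)) (identity (+ i) (+ r) (+ c) (+ (k ∸ c)))

  entry-vanishes-above-col₀ : ∀ i r → entry i r 0 (+ suc i) ≡ 0ℤ
  entry-vanishes-above-col₀ i r =
    trans (cong (binom i) (ℤ.+-identityʳ (+ suc i * + k + + r))) (binom-beyond-multiple i r)

  entry-vanishes-above-order₀ : ∀ r {c} → c < k → entry 0 r c (+ 1) ≡ 0ℤ
  entry-vanishes-above-order₀ r {c} c<k = cong (binom 0) argument
    where
    identity : ∀ R C E → + 1 * (+ 1 + (C + E)) + R - C ≡ + 1 + (E + R)
    identity = solve-∀
    argument : + 1 * + k + + r - + c ≡ + suc (k ∸ suc c ℕ.+ r)
    argument = subst (λ n → + 1 * + n + + r - + c ≡ + suc (k ∸ suc c ℕ.+ r))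
                     (sym (split-≤ c<k)) (identity (+ r) (+ c) (+ (k ∸ suc c)))

  entry-vanishes-negative : ∀ i {r} c n → r < k → entry i r c -[1+ n ] ≡ 0ℤ
  entry-vanishes-negative i {r} c n r<k =
    cong (binom i) (trans argument (cong (λ x → - (+ 1 + (+ e + + c + x))) (sym (ℤ.pos-* n k))))
    where
    e : ℕ
    e = k ∸ suc r
    identity : ∀ N R C E → - (+ 1 + N) * (+ 1 + (R + E)) + R - C ≡ - (+ 1 + (E + C + N * (+ 1 + (R + E))))
    identity = solve-∀
    argument : -[1+ n ] * + k + + r - + c ≡ - (+ 1 + (+ e + + c + + n * + k))
    argument = subst (λ m → -[1+ n ] * + m + + r - + c ≡ - (+ 1 + (+ e + + c + + n * + m)))
                     (sym (split-≤ r<k)) (identity (+ n) (+ r) (+ c) (+ e))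

  entry-vanishes-col-k : ∀ i {r} → r < k → entry i r k 0ℤ ≡ 0ℤ
  entry-vanishes-col-k i {r} r<k = cong (binom i) argument
    where
    identity : ∀ R E → R - (+ 1 + (R + E)) ≡ - (+ 1 + E)
    identity = solve-∀
    argument : + r - + k ≡ -[1+ k ∸ suc r ]
    argument = subst (λ m → + r - + m ≡ -[1+ k ∸ suc r ])
                     (sym (split-≤ r<k)) (identity (+ r) (+ (k ∸ suc r)))

  entry-col-k-shift : ∀ i r a → entry i r k (+ suc a) ≡ entry i r 0 (+ a)
  entry-col-k-shift i r a = cong (binom i) (identity (+ a) (+ r) (+ k))
    where
    identity : ∀ A R K → (+ 1 + A) * K + R - K ≡ A * K + R - 0ℤ
    identity = solve-∀

  -- Columns c range over 0 … k, one more than those of C_k^(i), so that Pascal's rule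
  -- holds uniformly; for such c every nonzero term of the sum over α has 0 ≤ α ≤ i + 1.
  weighted : (ℕ → ℤ) → ℕ → ℕ → ℕ → ℤ
  weighted w i r c = sumℕ (suc (suc i)) (λ a → w a * entry i r c (+ a))

  weighted-+ : ∀ v w i r c → weighted (λ a → v a + w a) i r c ≡ weighted v i r c + weighted w i r c
  weighted-+ v w i r c =
    trans (sumℕ-cong (suc (suc i)) (λ a → ℤ.*-distribʳ-+ (entry i r c (+ a)) (v a) (w a)))
          (sumℕ-+ (suc (suc i)) (λ a → v a * entry i r c (+ a)) (λ a → w a * entry i r c (+ a)))

  weighted-extend : ∀ w i r {c} → c ≤ k →
    sumℕ (suc (suc (suc i))) (λ a → w a * entry i r c (+ a)) ≡ weighted w i r c
  weighted-extend w i r c≤k = trans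
    (cong (_+_ (weighted w i r _)) (trans (cong (w _ *_) (entry-vanishes-above i r c≤k)) (ℤ.*-zeroʳ (w _))))
    (ℤ.+-identityʳ _)

  weighted-pascal : ∀ w i r {c} → c < k → weighted w (suc i) r c ≡ weighted w i r c + weighted w i r (suc c)
  weighted-pascal w i r {c} c<k = begin
    sumℕ (suc (suc (suc i))) (λ a → w a * entry (suc i) r c (+ a))
      ≡⟨ sumℕ-cong (suc (suc (suc i)))
           (λ a → trans (cong (w a *_) (entry-pascal i r c (+ a))) (ℤ.*-distribˡ-+ (w a) _ _)) ⟩
    sumℕ (suc (suc (suc i))) (λ a → w a * entry i r c (+ a) + w a * entry i r (suc c) (+ a))
      ≡⟨ sumℕ-+ (suc (suc (suc i))) (λ a → w a * entry i r c (+ a)) (λ a → w a * entry i r (suc c) (+ a)) ⟩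
    sumℕ (suc (suc (suc i))) (λ a → w a * entry i r c (+ a))
      + sumℕ (suc (suc (suc i))) (λ a → w a * entry i r (suc c) (+ a))
      ≡⟨ cong₂ _+_ (weighted-extend w i r (ℕ.<⇒≤ c<k)) (weighted-extend w i r c<k) ⟩
    weighted w i r c + weighted w i r (suc c) ∎

  weighted-wrap : ∀ w i {r} → r < k → weighted w i r k ≡ weighted (λ a → w (suc a)) i r 0
  weighted-wrap w i {r} r<k = begin
    sumℕ (suc (suc i)) (λ a → w a * entry i r k (+ a))
      ≡⟨ sumℕ-sucˡ (suc i) (λ a → w a * entry i r k (+ a)) ⟩
    w 0 * entry i r k 0ℤ + sumℕ (suc i) (λ a → w (suc a) * entry i r k (+ suc a))
      ≡⟨ cong₂ _+_ (trans (cong (w 0 *_) (entry-vanishes-col-k i r<k)) (ℤ.*-zeroʳ (w 0)))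
                   (sumℕ-cong (suc i) (λ a → cong (w (suc a) *_) (entry-col-k-shift i r a))) ⟩
    0ℤ + S
      ≡⟨ ℤ.+-identityˡ S ⟩
    S
      ≡⟨ ℤ.+-identityʳ S ⟨
    S + 0ℤ
      ≡⟨ cong (_+_ S) (trans (cong (w (suc (suc i)) *_) (entry-vanishes-above-col₀ i r))
                             (ℤ.*-zeroʳ (w (suc (suc i))))) ⟨
    weighted (λ a → w (suc a)) i r 0 ∎
    where
    S : ℤ
    S = sumℕ (suc i) (λ a → w (suc a) * entry i r 0 (+ a))

  Cext Text : ℕ → ℕ → ℕ → ℤ
  Cext = weighted (λ _ → 1ℤ)
  Text = weighted (λ a → + a)

  Cext-pascal : ∀ i r {c} → c < k → Cext (suc i) r c ≡ Cext i r c + Cext i r (suc c)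
  Cext-pascal = weighted-pascal (λ _ → 1ℤ)

  Text-pascal : ∀ i r {c} → c < k → Text (suc i) r c ≡ Text i r c + Text i r (suc c)
  Text-pascal = weighted-pascal (λ a → + a)

  Cext-wrap : ∀ i {r} → r < k → Cext i r k ≡ Cext i r 0
  Cext-wrap = weighted-wrap (λ _ → 1ℤ)

  Text-wrap : ∀ i {r} → r < k → Text i r k ≡ Cext i r 0 + Text i r 0
  Text-wrap i r<k = trans (weighted-wrap (λ a → + a) i r<k) (weighted-+ (λ _ → 1ℤ) (λ a → + a) i _ 0)

  Cext-base : ∀ r {c} → c < k → Cext 0 r c ≡ binom 0 (+ r - + c)
  Cext-base r {c} c<k =
    trans (cong (λ x → 0ℤ + 1ℤ * entry 0 r c 0ℤ + 1ℤ * x) (entry-vanishes-above-order₀ r c<k))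
          (unit (binom 0 (+ r - + c)))
    where
    unit : ∀ x → 0ℤ + 1ℤ * x + 1ℤ * 0ℤ ≡ x
    unit = solve-∀

  Text-base : ∀ r {c} → c < k → Text 0 r c ≡ 0ℤ
  Text-base r {c} c<k = cong (λ x → 0ℤ + + 0 * entry 0 r c 0ℤ + + 1 * x) (entry-vanishes-above-order₀ r c<k)

  Cmat-as-Cext : ∀ i (r s : Fin k) → Cmat k i r s ≡ Cext i (toℕ r) (toℕ s)
  Cmat-as-Cext i r s =
    trans (sumα-nonnegative i (entry i (toℕ r) (toℕ s))
                            (λ n → entry-vanishes-negative i (toℕ s) n (Fin.toℕ<n r)))
          (sumℕ-cong (suc (suc i)) (λ a → sym (ℤ.*-identityˡ _)))

  Tmat-as-Text : ∀ i (r s : Fin k) → Tmat k i r s ≡ Text i (toℕ r) (toℕ s)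
  Tmat-as-Text i r s = sumα-nonnegative i (λ α → α * entry i (toℕ r) (toℕ s) α)
    (λ n → trans (cong (-[1+ n ] *_) (entry-vanishes-negative i (toℕ s) n (Fin.toℕ<n r)))
                 (ℤ.*-zeroʳ -[1+ n ]))

  -- Iterated derivatives

  module Iterates (A D : Tuple k) where

    u : Seq
    u = IAP k A D

    Ccol Tcol : ℕ → ℕ → Tuple k
    Ccol i c r = Cext i (toℕ r) c
    Tcol i c r = Text i (toℕ r) c

    A′ D′ : ℕ → ℕ → ℤ
    A′ i c = A ∙ Ccol i c + D ∙ Tcol i c
    D′ i c = D ∙ Ccol i c

    A′-pascal : ∀ i {c} → c < k → A′ (suc i) c ≡ A′ i c + A′ i (suc c)
    A′-pascal i {c} c<k = begin
      A ∙ Ccol (suc i) c + D ∙ Tcol (suc i) c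
        ≡⟨ cong₂ _+_ (trans (∙-cong A (λ r → Cext-pascal i (toℕ r) c<k))
                            (∙-distribˡ-+ A (Ccol i c) (Ccol i (suc c))))
                     (trans (∙-cong D (λ r → Text-pascal i (toℕ r) c<k))
                            (∙-distribˡ-+ D (Tcol i c) (Tcol i (suc c)))) ⟩
      (A ∙ Ccol i c + A ∙ Ccol i (suc c)) + (D ∙ Tcol i c + D ∙ Tcol i (suc c))
        ≡⟨ interchange (A ∙ Ccol i c) (A ∙ Ccol i (suc c)) (D ∙ Tcol i c) (D ∙ Tcol i (suc c)) ⟩
      A′ i c + A′ i (suc c) ∎

    D′-pascal : ∀ i {c} → c < k → D′ (suc i) c ≡ D′ i c + D′ i (suc c)
    D′-pascal i {c} c<k =
      trans (∙-cong D (λ r → Cext-pascal i (toℕ r) c<k)) (∙-distribˡ-+ D (Ccol i c) (Ccol i (suc c)))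

    D′-wrap : ∀ i → D′ i k ≡ D′ i 0
    D′-wrap i = ∙-cong D (λ r → Cext-wrap i (Fin.toℕ<n r))

    A′-wrap : ∀ i → A′ i k ≡ A′ i 0 + D′ i 0
    A′-wrap i = begin
      A ∙ Ccol i k + D ∙ Tcol i k
        ≡⟨ cong₂ _+_ (∙-cong A (λ r → Cext-wrap i (Fin.toℕ<n r)))
                     (trans (∙-cong D (λ r → Text-wrap i (Fin.toℕ<n r)))
                            (∙-distribˡ-+ D (Ccol i 0) (Tcol i 0))) ⟩
      A ∙ Ccol i 0 + (D′ i 0 + D ∙ Tcol i 0)
        ≡⟨ regroup (A ∙ Ccol i 0) (D′ i 0) (D ∙ Tcol i 0) ⟩
      A′ i 0 + D′ i 0 ∎
      where
      regroup : ∀ a d t → a + (d + t) ≡ (a + t) + d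
      regroup = solve-∀

    A′-base : ∀ s → A′ 0 (toℕ s) ≡ A s
    A′-base s = begin
      A ∙ Ccol 0 (toℕ s) + D ∙ Tcol 0 (toℕ s)
        ≡⟨ cong₂ _+_ (trans (∙-cong A (λ r → Cext-base (toℕ r) (Fin.toℕ<n s))) (∙-δ A s))
                     (trans (∙-cong D (λ r → Text-base (toℕ r) (Fin.toℕ<n s))) (∙-zeroʳ D)) ⟩
      A s + 0ℤ ≡⟨ ℤ.+-identityʳ (A s) ⟩
      A s ∎

    D′-base : ∀ s → D′ 0 (toℕ s) ≡ D s
    D′-base s = trans (∙-cong D (λ r → Cext-base (toℕ r) (Fin.toℕ<n s))) (∙-δ D s)

    closed-form : ∀ i q (s : Fin k) →
                  ∂^ i u (q * + k + + toℕ s) ≡ -1ℤ ^ i * (A′ i (toℕ s) + q * D′ i (toℕ s))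
    closed-form-≤ : ∀ i q {c} → c ≤ k → ∂^ i u (q * + k + + c) ≡ -1ℤ ^ i * (A′ i c + q * D′ i c)

    closed-form zero q s = begin
      u (q * + k + + toℕ s)                   ≡⟨ IAP-at-qk+s A D q s ⟩
      A s + q * D s                           ≡⟨ cong₂ (λ a d → a + q * d) (A′-base s) (D′-base s) ⟨
      A′ 0 (toℕ s) + q * D′ 0 (toℕ s)         ≡⟨ ℤ.*-identityˡ _ ⟨
      1ℤ * (A′ 0 (toℕ s) + q * D′ 0 (toℕ s))  ∎
    closed-form (suc i) q s = begin
      - ∂^ i u j - ∂^ i u (j + + 1)
        ≡⟨ cong₂ (λ x y → - x - y) (closed-form i q s)
                 (trans (cong (∂^ i u) (next (q * + k) (+ toℕ s))) (closed-form-≤ i q (Fin.toℕ<n s))) ⟩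
      - (ε * (A′ i c + q * D′ i c)) - ε * (A′ i (suc c) + q * D′ i (suc c))
        ≡⟨ step ε (A′ i c) (D′ i c) (A′ i (suc c)) (D′ i (suc c)) q ⟩
      -1ℤ * ε * ((A′ i c + A′ i (suc c)) + q * (D′ i c + D′ i (suc c)))
        ≡⟨ cong₂ (λ a d → -1ℤ * ε * (a + q * d)) (A′-pascal i (Fin.toℕ<n s)) (D′-pascal i (Fin.toℕ<n s)) ⟨
      -1ℤ * ε * (A′ (suc i) c + q * D′ (suc i) c) ∎
      where
      j : ℤ
      j = q * + k + + toℕ s
      c : ℕ
      c = toℕ s
      ε : ℤ
      ε = -1ℤ ^ i
      next : ∀ X S → X + S + + 1 ≡ X + (+ 1 + S)
      next = solve-∀
      step : ∀ e a d a′ d′ q → - (e * (a + q * d)) - e * (a′ + q * d′) ≡ -1ℤ * e * ((a + a′) + q * (d + d′))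
      step = solve-∀

    closed-form-≤ i q {c} c≤k with ℕ.m≤n⇒m<n∨m≡n c≤k
    ... | inj₁ c<k = subst (λ c → ∂^ i u (q * + k + + c) ≡ -1ℤ ^ i * (A′ i c + q * D′ i c))
                           (Fin.toℕ-fromℕ< c<k) (closed-form i q (fromℕ< c<k))
    ... | inj₂ refl = begin
      ∂^ i u (q * + k + + k)                ≡⟨ cong (∂^ i u) (carry q (+ k)) ⟩
      ∂^ i u ((q + 1ℤ) * + k + 0ℤ)          ≡⟨ closed-form i (q + 1ℤ) zero ⟩
      ε * (A′ i 0 + (q + 1ℤ) * D′ i 0)      ≡⟨ cong (ε *_) (regroup (A′ i 0) (D′ i 0) q) ⟩
      ε * ((A′ i 0 + D′ i 0) + q * D′ i 0)  ≡⟨ cong₂ (λ a d → ε * (a + q * d)) (A′-wrap i) (D′-wrap i) ⟨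
      ε * (A′ i k + q * D′ i k)             ∎
      where
      ε : ℤ
      ε = -1ℤ ^ i
      carry : ∀ Q K → Q * K + K ≡ (Q + 1ℤ) * K + 0ℤ
      carry = solve-∀
      regroup : ∀ a d q → a + (q + 1ℤ) * d ≡ (a + d) + q * d
      regroup = solve-∀

    A′-matrix : ∀ i s → A′ i (toℕ s) ≡ ((A ⊛ Cmat k i) ⊕ (D ⊛ Tmat k i)) s
    A′-matrix i s =
      cong₂ _+_ (∙-cong A (λ r → sym (Cmat-as-Cext i r s))) (∙-cong D (λ r → sym (Tmat-as-Text i r s)))

    D′-matrix : ∀ i s → D′ i (toℕ s) ≡ (D ⊛ Cmat k i) s
    D′-matrix i s = ∙-cong D (λ r → sym (Cmat-as-Cext i r s))

proposition6 : (m k : ℕ) .{{_ : NonZero k}} (A D : Tuple k) (i : ℕ) →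
    ∂^ i (IAP k A D) ≈[mod m ]
      ((- + 1) ^ i) · IAP k ((A ⊛ Cmat k i) ⊕ (D ⊛ Tmat k i)) (D ⊛ Cmat k i)
proposition6 m (suc k′) A D i j = ≡⇒≡[mod] m (begin
  ∂^ i u j
    ≡⟨ cong (∂^ i u) (div-mod-decomposition j k) ⟩
  ∂^ i u (q * + k + + toℕ s)
    ≡⟨ closed-form i q s ⟩
  -1ℤ ^ i * (A′ i (toℕ s) + q * D′ i (toℕ s))
    ≡⟨ cong₂ (λ a d → -1ℤ ^ i * (a + q * d)) (A′-matrix i s) (D′-matrix i s) ⟩
  -1ℤ ^ i * (((A ⊛ Cmat k i) ⊕ (D ⊛ Tmat k i)) s + q * (D ⊛ Cmat k i) s) ∎)
  where
  open Period k′
  open Iterates A D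
  q : ℤ
  q = j /ℕ k
  s : Fin k
  s = fromℕ< (n%ℕd<d j k)
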